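{- Let $f$ be a problem that is $2$-weakly discontinuous. Then $\mathsf{LLPO}\le^*_W f$.
   Context: A problem is a partial multivalued function $f:\subseteq \mathbb{N}^\mathbb{N} \rightrightarrows \mathbb{N}^\mathbb{N}$; $\mathrm{dom}(f)$ is the set of $x$ with $f(x)\neq\emptyset$. Fix a standard computable pairing $\langle x,y\rangle$. $f\le^*_W g$ iff there are partial continuous $h,k:\subseteq\mathbb{N}^\mathbb{N}\to\mathbb{N}^\mathbb{N}$ such that for every $x\in\mathrm{dom}(f)$, $k(x)\in\mathrm{dom}(g)$ and for every $y\in g(k(x))$, $h(\langle x,y\rangle)\in f(x)$. For $x\in\mathbb{N}^\mathbb{N}$, $x|_n$ is its initial segment of length $n$. For positive $k$, $f$ is $k$-weakly continuous iff for every $x\in\mathrm{dom}(f)$ and every sequence $(y_n)_{n\in\mathbb{N}}\subseteq\mathrm{dom}(f)$ with $\lim_{n\to\infty}y_n=x$, there is $u\in f(x)$ such that for every $l<k$ and every $m\in\mathbb{N}$ there exist $n\ge m$ and $v\in f(y_{n\cdot k+l})$ with $u|_m=v|_m$; $k$-weakly discontinuous means not $k$-weakly continuous. With $\mathbf{n}$ the constant sequence of value $n$: $\mathsf{LLPO}$ has domain the sequences with at most one non-zero entry, and $\mathsf{LLPO}(x)$ contains $\mathbf{0}$ iff $x$ is zero at all even indices, and contains $\mathbf{1}$ iff $x$ is zero at all odd indices. -}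

module Defs where

open import Data.Nat using (ℕ; zero; suc; _+_; _*_; _<_; _≥_)
open import Data.Product using (Σ; ∃; _×_; _,_)
open import Data.Sum using (_⊎_)
open import Relation.Binary.PropositionalEquality using (_≡_; _≢_)
open import Relation.Nullary using (¬_)

Baire : Set
Baire = ℕ → ℕ

const : ℕ → Baire
const n _ = n

-- standard pairing: ⟨x,y⟩(2n) = x n, ⟨x,y⟩(2n+1) = y n
pair : Baire → Baire → Baire
pair x y zero = x zero
pair x y (suc zero) = y zero
pair x y (suc (suc n)) = pair (λ i → x (suc i)) (λ i → y (suc i)) n

Agree : Baire → Baire → ℕ → Set
Agree x y m = ∀ i → i < m → x i ≡ y i

_≐_ : Baire → Baire → Set
x ≐ y = ∀ i → x i ≡ y i

Converges : (ℕ → Baire) → Baire → Set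
Converges ys x = ∀ m → ∃ λ N → ∀ n → n ≥ N → Agree (ys n) x m

-- a problem: partial multivalued function, as a relation f x y ("y ∈ f(x)")
Problem : Set₁
Problem = Baire → Baire → Set

dom : Problem → Baire → Set
dom f x = ∃ λ y → f x y

record PartialContinuous : Set₁ where
  field
    Dom  : Baire → Set
    app  : (x : Baire) → Dom x → Baire
    cont : ∀ x (p : Dom x) (n : ℕ) → ∃ λ m →
             ∀ x' (p' : Dom x') → Agree x x' m → Agree (app x p) (app x' p') n
open PartialContinuous public

_≤*W_ : Problem → Problem → Set₁
f ≤*W g = Σ PartialContinuous λ h → Σ PartialContinuous λ k →
  ∀ x → dom f x →
    Σ (Dom k x) λ kx →
      dom g (app k x kx) ×
      (∀ y → g (app k x kx) y →
         Σ (Dom h (pair x y)) λ hxy → f x (app h (pair x y) hxy))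

-- k-weak continuity (k positive)
WeaklyContinuous : ℕ → Problem → Set
WeaklyContinuous k f =
  ∀ x → dom f x → ∀ (ys : ℕ → Baire) → (∀ n → dom f (ys n)) → Converges ys x →
    ∃ λ u → f x u × (∀ l → l < k → ∀ m → ∃ λ n → n ≥ m ×
      ∃ λ v → f (ys (n * k + l)) v × Agree u v m)

WeaklyDiscontinuous : ℕ → Problem → Set
WeaklyDiscontinuous k f = ¬ WeaklyContinuous k f

AtMostOneNonZero : Baire → Set
AtMostOneNonZero x = ∀ i j → x i ≢ 0 → x j ≢ 0 → i ≡ j

LLPO : Problem
LLPO x y = AtMostOneNonZero x ×
  ((y ≐ const 0 × (∀ i → x (2 * i) ≡ 0)) ⊎ (y ≐ const 1 × (∀ i → x (suc (2 * i)) ≡ 0)))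

{-# OPTIONS --safe #-}
-- Classically, 2-weak discontinuity of f yields x ∈ dom f and a sequence yₙ → x in dom f such
-- that every solution u of x has a prefix u|m shared by no solution of any y_{2n+l} with n ≥ m,
-- for some l < 2. An LLPO instance p is sent to y_{2i+1} or y_{2i} when its non-zero entry sits at
-- an even or odd position i, and to x when p = 0; this is continuous because yₙ → x. Given a
-- solution y, search for the first m such that either p(m) ≠ 0, whose parity gives the answer, or
-- y|m is separated from the solutions of y_{2n+l}, n ≥ m: then a non-zero entry of p, if any, lies
-- at some i ≥ m whose parity is determined by l, so 1 − l is a correct answer. If p = 0 then y
-- solves x, so the search halts. A reduction only has to be continuous, so both maps may decide
-- these properties by excluded middle.
module Submission where

open import Defs
open import Axiom.ExcludedMiddle using (ExcludedMiddle)
open import Axiom.DoubleNegationElimination using (em⇒dne)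
open import Level using (0ℓ)
open import Data.Bool using (Bool; true; false)
open import Data.Maybe using (Maybe; just; nothing)
open import Data.Maybe.Properties using (just-injective)
open import Data.Nat using (ℕ; zero; suc; _+_; _*_; _∸_; _<_; _≤_; _≥_; z≤n; s≤s)
open import Data.Nat.Properties
  using ( _≟_; +-suc; ≤-trans; ≤-refl; <⇒≤; n≤1+n; <-cmp; ≮⇒≥; m≤m*n; m≤m+n; m∸n≤m
        ; *-monoˡ-≤)
open import Data.Product using (∃; ∃₂; _×_; _,_; proj₁; proj₂)
open import Data.Sum using (_⊎_; inj₁; inj₂)
open import Data.Empty using (⊥-elim)
open import Function using (_$_)
open import Function.Bundles using (mk⇔)
open import Relation.Binary.Definitions using (tri<; tri≈; tri>)
open import Relation.Binary.PropositionalEquality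
  using (_≡_; _≢_; refl; sym; trans; cong; cong₂; subst)
open import Relation.Nullary using (¬_; Dec; yes; no; does; contradiction)
open import Relation.Nullary.Decidable using (does-⇔; decidable-stable)

llpoAnswer : ℕ → ℕ
llpoAnswer zero = 1
llpoAnswer (suc zero) = 0
llpoAnswer (suc (suc i)) = llpoAnswer i

llpoAnswer<2 : ∀ i → llpoAnswer i < 2
llpoAnswer<2 zero = s≤s (s≤s z≤n)
llpoAnswer<2 (suc zero) = s≤s z≤n
llpoAnswer<2 (suc (suc i)) = llpoAnswer<2 i

llpoAnswer-even : ∀ j → llpoAnswer (2 * j) ≡ 1
llpoAnswer-even zero = refl
llpoAnswer-even (suc j) rewrite +-suc j (j + 0) = llpoAnswer-even j

llpoAnswer-odd : ∀ j → llpoAnswer (suc (2 * j)) ≡ 0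
llpoAnswer-odd zero = refl
llpoAnswer-odd (suc j) rewrite +-suc j (j + 0) = llpoAnswer-odd j

bit-flip : ∀ {a b} → a < 2 → b < 2 → a ≢ b → a ≡ 1 ∸ b
bit-flip {0} {0} _ _ a≢b = contradiction refl a≢b
bit-flip {0} {1} _ _ _ = refl
bit-flip {1} {0} _ _ _ = refl
bit-flip {1} {1} _ _ a≢b = contradiction refl a≢b
bit-flip {suc (suc _)} (s≤s (s≤s ())) _ _
bit-flip {_} {suc (suc _)} _ (s≤s (s≤s ())) _

vanish-off-llpoAnswer : ∀ {p i} → AtMostOneNonZero p → p i ≢ 0 →
  ∀ j → llpoAnswer j ≢ llpoAnswer i → p j ≡ 0
vanish-off-llpoAnswer {p} {i} amo pi≢0 j aj≢ai =
  decidable-stable (p j ≟ 0) λ pj≢0 → aj≢ai (cong llpoAnswer (amo j i pj≢0 pi≢0))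

llpoAnswer-correct : ∀ {p i} → AtMostOneNonZero p → p i ≢ 0 → LLPO p (const (llpoAnswer i))
llpoAnswer-correct {p} {i} amo pi≢0 with llpoAnswer i in ai | llpoAnswer<2 i
... | 0 | _ = amo , inj₁ ((λ _ → refl) , λ j → vanish-off-llpoAnswer amo pi≢0 (2 * j) λ e →
  contradiction (trans (sym (llpoAnswer-even j)) (trans e ai)) λ ())
... | 1 | _ = amo , inj₂ ((λ _ → refl) , λ j → vanish-off-llpoAnswer amo pi≢0 (suc (2 * j)) λ e →
  contradiction (trans (sym (llpoAnswer-odd j)) (trans e ai)) λ ())
... | suc (suc _) | s≤s (s≤s ())

llpo-zero : ∀ {p r} → AtMostOneNonZero p → (∀ i → p i ≡ 0) → r < 2 → LLPO p (const r)
llpo-zero amo p≡0 (s≤s z≤n) = amo , inj₁ ((λ _ → refl) , λ i → p≡0 (2 * i))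
llpo-zero amo p≡0 (s≤s (s≤s z≤n)) = amo , inj₂ ((λ _ → refl) , λ i → p≡0 (suc (2 * i)))

Agree-sym : ∀ {x y m} → Agree x y m → Agree y x m
Agree-sym x≈y i i<m = sym (x≈y i i<m)

Agree-≤ : ∀ {x y m n} → n ≤ m → Agree x y m → Agree x y n
Agree-≤ n≤m x≈y i i<n = x≈y i (≤-trans i<n n≤m)

evens odds : Baire → Baire
evens q i = q (i * 2)
odds q i = q (suc (i * 2))

evens-pair : ∀ x y i → evens (pair x y) i ≡ x i
evens-pair x y zero = refl
evens-pair x y (suc i) = evens-pair (λ j → x (suc j)) (λ j → y (suc j)) i

odds-pair : ∀ x y i → odds (pair x y) i ≡ y i
odds-pair x y zero = refl
odds-pair x y (suc i) = odds-pair (λ j → x (suc j)) (λ j → y (suc j)) i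

module _ {A : Set} where

  FirstJust : (ℕ → Maybe A) → ℕ → A → Set
  FirstJust g m a = (∀ k → k < m → g k ≡ nothing) × g m ≡ just a

  firstJust-unique : ∀ {g m m′ a a′} → FirstJust g m a → FirstJust g m′ a′ → a ≡ a′
  firstJust-unique {m = m} {m′} (before , at) (before′ , at′) with <-cmp m m′
  ... | tri< m<m′ _ _ = contradiction (trans (sym at) (before′ m m<m′)) λ ()
  ... | tri≈ _ refl _ = just-injective (trans (sym at) at′)
  ... | tri> _ _ m′<m = contradiction (trans (sym at′) (before m′ m′<m)) λ ()

  firstJust-exists : ∀ g m {a} → g m ≡ just a → ∃₂ (FirstJust g)
  firstJust-exists g zero {a} at = zero , a , (λ _ ()) , at
  firstJust-exists g (suc m) at with g zero in at₀
  ... | just a₀ = zero , a₀ , (λ _ ()) , at₀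
  ... | nothing with firstJust-exists (λ k → g (suc k)) m at
  ...   | m′ , a′ , before , at′ = suc m′ , a′ , before′ , at′
    where
    before′ : ∀ k → k < suc m′ → g k ≡ nothing
    before′ zero _ = at₀
    before′ (suc k) (s≤s k<m′) = before k k<m′

  firstJust-transfer : ∀ {g g′ m a} → (∀ k → k ≤ m → g k ≡ g′ k) →
    FirstJust g m a → FirstJust g′ m a
  firstJust-transfer g≡g′ (before , at) =
    (λ k k<m → trans (sym (g≡g′ k (<⇒≤ k<m))) (before k k<m)) , trans (sym (g≡g′ _ ≤-refl)) at

module Search {A : Set} (stage : Baire → ℕ → Maybe A) (out : A → Baire) (modulus : ℕ → ℕ)
  (modulus-mono : ∀ {k m} → k ≤ m → modulus k ≤ modulus m)
  (stage-local : ∀ {q q′ m} → Agree q q′ (modulus m) → stage q m ≡ stage q′ m) where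

  search : PartialContinuous
  search = record
    { Dom = λ q → ∃₂ (FirstJust (stage q))
    ; app = λ _ (_ , a , _) → out a
    ; cont = search-continuous
    }
    where
    search-continuous : ∀ q (d : ∃₂ (FirstJust (stage q))) n →
      ∃ λ N → ∀ q′ (d′ : ∃₂ (FirstJust (stage q′))) →
        Agree q q′ N → Agree (out (proj₁ (proj₂ d))) (out (proj₁ (proj₂ d′))) n
    search-continuous q (m , a , first) n = modulus m , λ { q′ (_ , a′ , first′) q≈q′ i _ →
      cong (λ b → out b i) (firstJust-unique (firstJust-transfer
        (λ k k≤m → stage-local (Agree-≤ (modulus-mono k≤m) q≈q′)) first) first′) }

HasNonZero : Baire → Set
HasNonZero p = ∃ λ i → p i ≢ 0

¬HasNonZero⇒zero : ∀ {p} → ¬ HasNonZero p → ∀ i → p i ≡ 0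
¬HasNonZero⇒zero {p} none i = decidable-stable (p i ≟ 0) λ pi≢0 → none (i , pi≢0)

nonzero-transfer : ∀ {p p′ i} → p i ≢ 0 → Agree p p′ (suc i) → p′ i ≢ 0
nonzero-transfer {i = i} pi≢0 p≈p′ p′i≡0 = pi≢0 (trans (p≈p′ i ≤-refl) p′i≡0)

nonzero-beyond-agreement : ∀ {p p′ N i} → (∀ j → p j ≡ 0) → Agree p p′ N → p′ i ≢ 0 → N ≤ i
nonzero-beyond-agreement {i = i} p≡0 p≈p′ p′i≢0 =
  ≮⇒≥ λ i<N → p′i≢0 (trans (sym (p≈p′ i i<N)) (p≡0 i))

module Selector (x : Baire) (ys : ℕ → Baire) (ys→x : Converges ys x)
  (σ : ℕ → ℕ) (σ-inflationary : ∀ i → i ≤ σ i) where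

  choose : (p : Baire) → Dec (HasNonZero p) → Baire
  choose p (yes (i , _)) = ys (σ i)
  choose p (no _) = x

  choose-continuous : ∀ p (p? : Dec (HasNonZero p)) n → ∃ λ N → ∀ p′ → AtMostOneNonZero p′ →
    (p′? : Dec (HasNonZero p′)) → Agree p p′ N → Agree (choose p p?) (choose p′ p′?) n
  choose-continuous p (yes (i , pi≢0)) n = suc i , λ where
    p′ amo′ (yes (i′ , p′i′≢0)) p≈p′ →
      subst (λ j → Agree (ys (σ i)) (ys (σ j)) n)
        (amo′ i i′ (nonzero-transfer pi≢0 p≈p′) p′i′≢0) (λ _ _ → refl)
    p′ amo′ (no none) p≈p′ → ⊥-elim (none (i , nonzero-transfer pi≢0 p≈p′))
  choose-continuous p (no none) n = proj₁ (ys→x n) , λ where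
    p′ _ (no _) _ _ _ → refl
    p′ _ (yes (i′ , p′i′≢0)) p≈p′ →
      Agree-sym (proj₂ (ys→x n) (σ i′)
        (≤-trans (nonzero-beyond-agreement (¬HasNonZero⇒zero none) p≈p′ p′i′≢0)
                 (σ-inflationary i′)))

  selector : ExcludedMiddle 0ℓ → PartialContinuous
  selector lem = record
    { Dom = AtMostOneNonZero
    ; app = λ p _ → choose p lem
    ; cont = λ p _ n → let N , agree = choose-continuous p lem n in
                       N , λ p′ amo′ → agree p′ amo′ lem
    }

Separated : Problem → (ℕ → Baire) → (k l m : ℕ) → Baire → Set
Separated f ys k l m u = ∀ n → n ≥ m → ∀ v → f (ys (n * k + l)) v → ¬ Agree u v m

Separated-transfer : ∀ {f ys k l m u u′} → Agree u u′ m →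
  Separated f ys k l m u → Separated f ys k l m u′
Separated-transfer u≈u′ sep n n≥m v fv u′≈v =
  sep n n≥m v fv λ i i<m → trans (u≈u′ i i<m) (u′≈v i i<m)

record DiscontinuityWitness (k : ℕ) (f : Problem) : Set where
  field
    x : Baire
    x∈dom : dom f x
    ys : ℕ → Baire
    ys∈dom : ∀ n → dom f (ys n)
    ys→x : Converges ys x
    separated : ∀ u → f x u → ∃ λ l → l < k × ∃ λ m → Separated f ys k l m u

module Classical (lem : ExcludedMiddle 0ℓ) where

  ¬∀⇒∃¬ : {A : Set} {P : A → Set} → ¬ (∀ a → P a) → ∃ λ a → ¬ P a
  ¬∀⇒∃¬ ¬∀ = em⇒dne lem λ ¬∃ → ¬∀ λ a → em⇒dne lem λ ¬Pa → ¬∃ (a , ¬Pa)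

  ¬→⇒×¬ : {A B : Set} → ¬ (A → B) → A × ¬ B
  ¬→⇒×¬ ¬→ = em⇒dne lem (λ ¬a → ¬→ λ a → contradiction a ¬a) , λ b → ¬→ λ _ → b

  weaklyDiscontinuous⇒witness : ∀ {k f} → WeaklyDiscontinuous k f → DiscontinuityWitness k f
  weaklyDiscontinuous⇒witness {k} {f} disc
    with x , ¬₁ ← ¬∀⇒∃¬ disc
    with x∈dom , ¬₂ ← ¬∀⇒∃¬ ¬₁
    with ys , ¬₃ ← ¬∀⇒∃¬ ¬₂
    with ys∈dom , ¬₄ ← ¬∀⇒∃¬ ¬₃
    with ys→x , ¬₅ ← ¬∀⇒∃¬ ¬₄
    = record
      { x = x ; x∈dom = x∈dom ; ys = ys ; ys∈dom = ys∈dom ; ys→x = ys→x ; separated = separated }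
    where
    separated : ∀ u → f x u → ∃ λ l → l < k × ∃ λ m → Separated f ys k l m u
    separated u fxu with l , ¬close ← ¬∀⇒∃¬ (λ close → ¬₅ (u , fxu , close))
                   with l<k , ¬close′ ← ¬→⇒×¬ ¬close
                   with m , ¬close″ ← ¬∀⇒∃¬ ¬close′
      = l , l<k , m , λ n n≥m v fv u≈v → ¬close″ (n , n≥m , v , fv , u≈v)

-- Only the Booleans `does` of the decisions enter the verdict, so logically equivalent
-- propositions, and hence agreeing prefixes, give the same verdict.
stageVerdict : ℕ → Bool → Bool → Bool → Maybe ℕ
stageVerdict m false _ _ = just (llpoAnswer m)
stageVerdict m true true _ = just 1
stageVerdict m true false true = just 0
stageVerdict m true false false = nothing

module _ {A : Set} {B : ℕ → Set} where

  verdict : ∀ m → Dec A → Dec (B 0) → Dec (B 1) → Maybe ℕ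
  verdict m a? b₀? b₁? = stageVerdict m (does a?) (does b₀?) (does b₁?)

  verdict-just : ∀ {m} a? b₀? b₁? {r} → verdict m a? b₀? b₁? ≡ just r →
    (¬ A × r ≡ llpoAnswer m) ⊎ ∃ λ l → l < 2 × B l × r ≡ 1 ∸ l
  verdict-just (no ¬a) _ _ refl = inj₁ (¬a , refl)
  verdict-just (yes _) (yes b₀) _ refl = inj₂ (0 , s≤s z≤n , b₀ , refl)
  verdict-just (yes _) (no _) (yes b₁) refl = inj₂ (1 , s≤s (s≤s z≤n) , b₁ , refl)
  verdict-just (yes _) (no _) (no _) ()

  verdict-nothing : ∀ {m} a? b₀? b₁? → verdict m a? b₀? b₁? ≡ nothing → A
  verdict-nothing (yes a) _ _ _ = a
  verdict-nothing (no _) _ _ ()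

  verdict-halts : ∀ {m} a? b₀? b₁? → (¬ A ⊎ ∃ λ l → l < 2 × B l) →
    ∃ λ r → verdict m a? b₀? b₁? ≡ just r
  verdict-halts (no _) _ _ _ = _ , refl
  verdict-halts (yes a) _ _ (inj₁ ¬a) = contradiction a ¬a
  verdict-halts (yes _) (yes _) _ (inj₂ _) = 1 , refl
  verdict-halts (yes _) (no _) (yes _) (inj₂ _) = 0 , refl
  verdict-halts (yes _) (no ¬b₀) (no _) (inj₂ (0 , _ , b₀)) = contradiction b₀ ¬b₀
  verdict-halts (yes _) (no _) (no ¬b₁) (inj₂ (1 , _ , b₁)) = contradiction b₁ ¬b₁
  verdict-halts (yes _) (no _) (no _) (inj₂ (suc (suc _) , s≤s (s≤s ()) , _))

module Reduction (lem : ExcludedMiddle 0ℓ) (f : Problem) (w : DiscontinuityWitness 2 f) where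
  open DiscontinuityWitness w

  σ : ℕ → ℕ
  σ i = i * 2 + llpoAnswer i

  σ-inflationary : ∀ i → i ≤ σ i
  σ-inflationary i = ≤-trans (m≤m*n i 2) (m≤m+n (i * 2) (llpoAnswer i))

  open Selector x ys ys→x σ σ-inflationary using (choose; selector)

  choose-dom : ∀ p p? → dom f (choose p p?)
  choose-dom p (yes (i , _)) = ys∈dom (σ i)
  choose-dom p (no _) = x∈dom

  Sep : ℕ → ℕ → Baire → Set
  Sep = Separated f ys 2

  Sep-transfer : ∀ {l m u u′} → Agree u u′ m → Sep l m u → Sep l m u′
  Sep-transfer = Separated-transfer {f = f} {ys}

  stage : Baire → ℕ → Maybe ℕ
  stage q m = verdict {B = λ l → Sep l m (odds q)} m
    (evens q m ≟ 0) (lem {Sep 0 m (odds q)}) (lem {Sep 1 m (odds q)})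

  stage-nothing : ∀ {q m} → stage q m ≡ nothing → evens q m ≡ 0
  stage-nothing {q} {m} = verdict-nothing {B = λ l → Sep l m (odds q)} (evens q m ≟ 0) lem lem

  stage-just : ∀ {q m r} → stage q m ≡ just r →
    (evens q m ≢ 0 × r ≡ llpoAnswer m) ⊎ ∃ λ l → l < 2 × Sep l m (odds q) × r ≡ 1 ∸ l
  stage-just {q} {m} = verdict-just {B = λ l → Sep l m (odds q)} (evens q m ≟ 0) lem lem

  stage-halts : ∀ {q m} → (evens q m ≢ 0 ⊎ ∃ λ l → l < 2 × Sep l m (odds q)) →
    ∃ λ r → stage q m ≡ just r
  stage-halts {q} {m} = verdict-halts {B = λ l → Sep l m (odds q)} (evens q m ≟ 0) lem lem

  stage-local : ∀ {q q′ m} → Agree q q′ (suc m * 2) → stage q m ≡ stage q′ m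
  stage-local {q} {q′} {m} q≈q′ =
    cong₂ _$_ (cong₂ (stageVerdict m) same-entry (same-sep 0)) (same-sep 1)
    where
    same-entry : does (evens q m ≟ 0) ≡ does (evens q′ m ≟ 0)
    same-entry = cong (λ v → does (v ≟ 0)) (q≈q′ (m * 2) (s≤s (n≤1+n (m * 2))))
    odds≈ : Agree (odds q) (odds q′) m
    odds≈ i i<m = q≈q′ (suc (i * 2)) (s≤s (s≤s (*-monoˡ-≤ 2 (<⇒≤ i<m))))
    same-sep : ∀ l → does (lem {Sep l m (odds q)}) ≡ does (lem {Sep l m (odds q′)})
    same-sep l = does-⇔ (mk⇔ (Sep-transfer odds≈) (Sep-transfer (Agree-sym odds≈))) lem lem

  search-halts : ∀ {p y} p? → f (choose p p?) y → ∃₂ (FirstJust (stage (pair p y)))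
  search-halts {p} {y} (yes (i , pi≢0)) _ = firstJust-exists _ i $ proj₂ $
    stage-halts {pair p y} (inj₁ λ qi≡0 → pi≢0 (trans (sym (evens-pair p y i)) qi≡0))
  search-halts {p} {y} (no _) fy with separated y fy
  ... | l , l<2 , m , sep = firstJust-exists _ m $ proj₂ $
    stage-halts {pair p y} (inj₂ (l , l<2 , Sep-transfer (λ i _ → sym (odds-pair p y i)) sep))

  separated-verdict-correct : ∀ {p y m l} → AtMostOneNonZero p → ∀ p? → f (choose p p?) y →
    (∀ k → k < m → stage (pair p y) k ≡ nothing) → l < 2 → Sep l m (odds (pair p y)) →
    LLPO p (const (1 ∸ l))
  separated-verdict-correct {l = l} amo (no none) _ _ _ _ =
    llpo-zero amo (¬HasNonZero⇒zero none) (s≤s (m∸n≤m 1 l))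
  separated-verdict-correct {p} {y} {m} {l} amo (yes (i , pi≢0)) fy before l<2 sep =
    subst (λ r → LLPO p (const r)) (bit-flip (llpoAnswer<2 i) l<2 answer≢l)
      (llpoAnswer-correct amo pi≢0)
    where
    m≤i : m ≤ i
    m≤i = ≮⇒≥ λ i<m →
      pi≢0 (trans (sym (evens-pair p y i)) (stage-nothing {pair p y} (before i i<m)))
    answer≢l : llpoAnswer i ≢ l
    answer≢l refl = sep i m≤i y fy λ j _ → odds-pair p y j

  search-correct : ∀ {p y m r} → AtMostOneNonZero p → ∀ p? → f (choose p p?) y →
    FirstJust (stage (pair p y)) m r → LLPO p (const r)
  search-correct {p} {y} {m} amo p? fy (before , at) with stage-just {pair p y} at
  ... | inj₁ (pm≢0 , refl) = llpoAnswer-correct amo λ pm≡0 → pm≢0 (trans (evens-pair p y m) pm≡0)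
  ... | inj₂ (l , l<2 , sep , refl) = separated-verdict-correct amo p? fy before l<2 sep

  llpo≤f : LLPO ≤*W f
  llpo≤f = Search.search stage const (λ m → suc m * 2) (λ k≤m → *-monoˡ-≤ 2 (s≤s k≤m)) stage-local
         , selector lem
         , λ p (_ , amo , _) → amo , choose-dom p lem , λ y fy →
             search-halts lem fy , search-correct amo lem fy (proj₂ (proj₂ (search-halts lem fy)))

lemma3p5 : ExcludedMiddle 0ℓ → (f : Problem) → WeaklyDiscontinuous 2 f → LLPO ≤*W f
lemma3p5 lem f disc = Reduction.llpo≤f lem f (Classical.weaklyDiscontinuous⇒witness lem disc)
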